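{- Let $q_1,\ldots,q_k\geq 1$ be integers and let $g_I$, for $I\subseteq\{1,\ldots,k\}$, be their relative greatest common divisors. Then: (1) for every $1\leq i\leq k$, $q_i=\prod_{I\ni i}g_I$; (2) if $\gcd(g_I,g_J)>1$ then $I\subseteq J$ or $J\subseteq I$; (3) if all $q_i$ are squarefree then $\gcd(g_I,g_J)=1$ for all $I\neq J$.
   Context: Relative greatest common divisors: set $g_\emptyset=1$. For nonempty $I\subseteq\{1,\ldots,k\}$, the positive integer $g_I$ is defined prime by prime: fix a prime $p$, write $v_p$ for the $p$-adic valuation, and reorder indices via a permutation $\sigma$ so that $v_p(q_{\sigma(1)})\leq\cdots\leq v_p(q_{\sigma(k)})$. Then the exponent of $p$ in $g_I$ is $v_p(q_{\sigma(1)})$ if $I=\{\sigma(1),\ldots,\sigma(k)\}=\{1,\ldots,k\}$, is $v_p(q_{\sigma(i)})-v_p(q_{\sigma(i-1)})$ if $I=\{\sigma(i),\ldots,\sigma(k)\}$ for some $2\leq i\leq k$, and is $0$ for all other $I$. -}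

module Defs where

open import Data.Nat using (ℕ; zero; suc; _+_; _*_; _∸_; _^_; _≤_; _<_; _≤ᵇ_)
open import Data.Nat.Divisibility using (_∣_)
open import Data.Nat.Primality using (Prime)
open import Data.Fin using (Fin; toℕ)
open import Data.Fin.Subset using (Subset) renaming (⊥ to ∅)
open import Data.Fin.Permutation using (Permutation′; _⟨$⟩ʳ_; _⟨$⟩ˡ_)
open import Data.Bool using (Bool; true; false; if_then_else_)
open import Data.Vec using (Vec; []; _∷_; tabulate; lookup)
open import Data.List using (List; []; _∷_; map; _++_)
open import Data.Nat.ListAction using (product)
open import Data.Product using (_×_)
open import Relation.Binary.PropositionalEquality using (_≡_; _≢_)
open import Relation.Nullary using (¬_)

IsVal : ℕ → ℕ → ℕ → Set
IsVal p n e = (p ^ e ∣ n) × ¬ (p ^ suc e ∣ n)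

SquareFree : ℕ → Set
SquareFree n = ∀ d → 1 < d → ¬ (d * d ∣ n)

Sorted : ∀ {k} → (Fin k → ℕ) → Permutation′ k → Set
Sorted {k} v σ = ∀ (i j : Fin k) → toℕ i ≤ toℕ j → v (σ ⟨$⟩ʳ i) ≤ v (σ ⟨$⟩ʳ j)

-- the set {σ(i), …, σ(k-1)} (0-indexed), i.e. all j whose position σ⁻¹(j) is ≥ i
tailSet : ∀ {k} → Permutation′ k → ℕ → Subset k
tailSet σ i = tabulate (λ j → i ≤ᵇ toℕ (σ ⟨$⟩ˡ j))

-- e is the exponent of p in g_I, given sorted valuations v ∘ σ (paper's definition,
-- 0-indexed: paper's index i corresponds to position i-1 here)
ExpoSpec : ∀ {k} → (Fin k → ℕ) → Permutation′ k → Subset k → ℕ → Set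
ExpoSpec {k} v σ I e =
    (∀ (i : Fin k) → toℕ i ≡ 0 → I ≡ tailSet σ 0 → e ≡ v (σ ⟨$⟩ʳ i))
  × (∀ (i j : Fin k) → toℕ j ≡ suc (toℕ i) → I ≡ tailSet σ (toℕ j)
       → e ≡ v (σ ⟨$⟩ʳ j) ∸ v (σ ⟨$⟩ʳ i))
  × ((∀ (i : Fin k) → I ≢ tailSet σ (toℕ i)) → e ≡ 0)

IsRelGCD : ∀ {k} → (Fin k → ℕ) → (Subset k → ℕ) → Set
IsRelGCD {k} q g =
    (g ∅ ≡ 1)
  × (∀ I → I ≢ ∅ → 1 ≤ g I)
  × (∀ p → Prime p → ∀ (v : Fin k → ℕ) → (∀ i → IsVal p (q i) (v i))
       → ∀ (σ : Permutation′ k) → Sorted v σ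
       → ∀ I → I ≢ ∅ → ∀ e → ExpoSpec v σ I e → IsVal p (g I) e)

allSubsets : ∀ k → List (Subset k)
allSubsets zero = [] ∷ []
allSubsets (suc k) = map (false ∷_) (allSubsets k) ++ map (true ∷_) (allSubsets k)

prodContaining : ∀ {k} → (Subset k → ℕ) → Fin k → ℕ
prodContaining {k} g i = product (map (λ I → if lookup I i then g I else 1) (allSubsets k))

-- Fix a prime p, let v i be the p-adic valuation of q i and let σ sort these valuations,
-- w 0 ≤ w 1 ≤ … ≤ w (k-1).  The definition of g gives g I the p-exponent Δw m = w m ∸ w (m-1)
-- when I is the tail set T m = {σ m, …, σ (k-1)}, and the p-exponent 0 when I is no tail set.
-- An index i lies in exactly the tail sets T 0, …, T (σ⁻¹ i), so the p-exponents of the g I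
-- with i ∈ I telescope to w (σ⁻¹ i) = v i; as a positive integer is determined by its
-- valuations, this is (1).  A prime dividing g I and g J makes both I and J tail sets, and the
-- tail sets form a chain, whence (2).  For squarefree q i all w m are 0 or 1, so at most one
-- increment Δw m is positive and no prime divides g I and g J for I ≢ J, whence (3).
module Submission where

open import Data.Nat
open import Data.Nat.Properties
open import Data.Nat.Divisibility
open import Data.Nat.GCD using (gcd; gcd[m,n]∣m; gcd[m,n]∣n; gcd[m,n]≢0)
open import Data.Nat.Induction using (<-wellFounded)
open import Data.Nat.ListAction using (sum; product)
open import Data.Nat.ListAction.Properties using (sum-++)
open import Data.Nat.Primality
open import Data.Nat.Primality.Factorisation using (factorise)
open import Data.Nat.Solver using (module +-*-Solver)
open import Algebra.Properties.CommutativeSemigroup +-commutativeSemigroup using (interchange)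
open import Data.Bool using (true; false; if_then_else_)
import Data.Bool as Bool
open import Data.Bool.Properties using (T-≡)
open import Data.Fin using (Fin; zero; suc; toℕ; fromℕ<)
open import Data.Fin.Properties using (toℕ-fromℕ<; fromℕ<-toℕ; toℕ<n) renaming (_≟_ to _≟ᶠ_)
open import Data.Fin.Permutation
  using (Permutation′; _⟨$⟩ʳ_; _⟨$⟩ˡ_; inverseˡ; inverseʳ; lift₀; transpose; _∘ₚ_; id)
import Data.Fin.Permutation.Components as PC
open import Data.Fin.Subset using (Subset; _⊆_) renaming (⊥ to ∅)
open import Data.List using (List; []; _∷_; map; _++_)
open import Data.List.Properties using (map-++; map-∘; map-cong)
open import Data.List.Relation.Unary.All using (_∷_)
open import Data.Vec using ([]; _∷_; lookup)
open import Data.Vec.Properties using (≡-dec; lookup∘tabulate; lookup-replicate; []=⇒lookup; lookup⇒[]=)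
open import Data.Product using (Σ; ∃; _×_; _,_; proj₁; proj₂)
open import Data.Sum using (_⊎_; inj₁; inj₂; [_,_]′)
open import Function using (_∘_; Equivalence)
open import Induction.WellFounded using (Acc; acc)
open import Relation.Binary.Definitions using (DecidableEquality; tri<; tri≈; tri>)
open import Relation.Binary.PropositionalEquality
open import Relation.Nullary
open import Relation.Nullary.Decidable using (dec-true)
open import Defs

open +-*-Solver using (solve; _:*_; _:=_)

private variable
  a b e e′ k m n p : ℕ
  f h : ℕ → ℕ

-- p-adic valuations

record Valuation (p n e : ℕ) : Set where
  constructor valuation
  field
    cofactor : ℕ
    n≡p^e*cofactor : n ≡ p ^ e * cofactor
    p∤cofactor : ¬ p ∣ cofactor

open Valuation

prime⇒¬∣1 : Prime p → ¬ p ∣ 1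
prime⇒¬∣1 pr p∣1 = ¬prime[1] (subst Prime (∣1⇒≡1 p∣1) pr)

valuation⇒isVal : Prime p → Valuation p n e → IsVal p n e
valuation⇒isVal {p} {e = e} pr (valuation m refl p∤m) =
  divides m (*-comm (p ^ e) m) ,
  λ p^1+e∣n → p∤m (*-cancelˡ-∣ (p ^ e) (subst (_∣ p ^ e * m) (*-comm p (p ^ e)) p^1+e∣n))
  where instance _ = m^n≢0 p e {{prime⇒nonZero pr}}

isVal⇒valuation : IsVal p n e → Valuation p n e
isVal⇒valuation {p} {e = e} (divides m refl , p^1+e∤n) =
  valuation m (*-comm m (p ^ e)) λ p∣m → p^1+e∤n (subst (p * p ^ e ∣_) (*-comm (p ^ e) m)
    (subst (_∣ p ^ e * m) (*-comm (p ^ e) p) (*-monoʳ-∣ (p ^ e) p∣m)))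

valuation-1 : Prime p → Valuation p 1 0
valuation-1 pr = valuation 1 refl (prime⇒¬∣1 pr)

valuation-nonZero : Prime p → Valuation p n e → 1 ≤ n
valuation-nonZero {p} _ (valuation zero _ p∤0) = contradiction (p ∣0) p∤0
valuation-nonZero {p} {e = e} pr (valuation (suc m) refl _) =
  *-mono-≤ (m^n>0 p {{prime⇒nonZero pr}} e) (s≤s (z≤n {m}))

∣⇒valuation>0 : Valuation p n e → p ∣ n → 1 ≤ e
∣⇒valuation>0 {e = suc e} _ _ = s≤s z≤n
∣⇒valuation>0 {p} {e = zero} (valuation m refl p∤m) p∣n = contradiction (subst (p ∣_) (*-identityˡ m) p∣n) p∤m

valuation-* : Prime p → Valuation p a e → Valuation p b e′ → Valuation p (a * b) (e + e′)
valuation-* {p} {e = e} {e′ = e′} pr (valuation m refl p∤m) (valuation m′ refl p∤m′) =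
  valuation (m * m′) (begin
    p ^ e * m * (p ^ e′ * m′)
      ≡⟨ solve 4 (λ x m y m′ → x :* m :* (y :* m′) := x :* y :* (m :* m′)) refl (p ^ e) m (p ^ e′) m′ ⟩
    p ^ e * p ^ e′ * (m * m′)
      ≡⟨ cong (_* (m * m′)) (^-distribˡ-+-* p e e′) ⟨
    p ^ (e + e′) * (m * m′)     ∎)
    ([ p∤m , p∤m′ ]′ ∘ euclidsLemma m m′ pr)
  where open ≡-Reasoning

valuation>0⇒∣ : Valuation p n (suc e) → p ∣ n
valuation>0⇒∣ {p} {e = e} (valuation m refl _) = ∣-trans (m∣m*n (p ^ e)) (m∣m*n m)

valuation-unique : Prime p → Valuation p n e → Valuation p n e′ → e ≡ e′
valuation-unique {e = zero}  {e′ = zero}  _ _ _ = refl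
valuation-unique {e = zero}  {e′ = suc e′} _ v v′ = contradiction (∣⇒valuation>0 v (valuation>0⇒∣ v′)) λ ()
valuation-unique {e = suc e} {e′ = zero}  _ v v′ = contradiction (∣⇒valuation>0 v′ (valuation>0⇒∣ v)) λ ()
valuation-unique {p} {e = suc e} {e′ = suc e′} pr (valuation m refl p∤m) (valuation m′ eq p∤m′) =
  cong suc (valuation-unique pr (valuation m refl p∤m) (valuation m′ p^e*m≡p^e′*m′ p∤m′))
  where
  instance _ = prime⇒nonZero pr
  p^e*m≡p^e′*m′ : p ^ e * m ≡ p ^ e′ * m′
  p^e*m≡p^e′*m′ = *-cancelˡ-≡ _ _ p (trans (sym (*-assoc p (p ^ e) m)) (trans eq (*-assoc p (p ^ e′) m′)))

valuation-exists : Prime p → 1 ≤ n → ∃ (Valuation p n)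
valuation-exists {p} pr = go (<-wellFounded _)
  where
  go : Acc _<_ n → 1 ≤ n → ∃ (Valuation p n)
  go {n} (acc rec) n≥1 with p ∣? n
  ... | no p∤n = 0 , valuation n (sym (*-identityˡ n)) p∤n
  ... | yes (divides zero refl) = contradiction n≥1 λ ()
  ... | yes (divides n′@(suc _) refl) =
    let e , valuation m n′≡p^e*m p∤m = go (rec (m<m*n n′ p p>1)) (s≤s z≤n)
    in suc e , valuation m (begin
      n′ * p          ≡⟨ *-comm n′ p ⟩
      p * n′          ≡⟨ cong (p *_) n′≡p^e*m ⟩
      p * (p ^ e * m) ≡⟨ *-assoc p (p ^ e) m ⟨
      p * p ^ e * m   ∎) p∤m
    where
    open ≡-Reasoning
    p>1 : 1 < p
    p>1 = nonTrivial⇒n>1 p {{prime⇒nonTrivial pr}}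

valuation-cancelˡ : Prime p → 1 ≤ b → Valuation p a e → Valuation p (a * b) (e + e′) → Valuation p b e′
valuation-cancelˡ {p} {b} {e = e} {e′} pr b≥1 va vab =
  let e″ , vb = valuation-exists pr b≥1
  in subst (Valuation p b) (+-cancelˡ-≡ e e″ e′ (valuation-unique pr (valuation-* pr va vb) vab)) vb

primeDivisor : 1 < n → ∃ λ p → Prime p × p ∣ n
primeDivisor {n} (s≤s (s≤s _)) with factorise n
... | record { factors = p ∷ ps ; isFactorisation = n≡p*∏ps ; factorsPrime = pr ∷ _ } =
  p , pr , divides (product ps) (trans n≡p*∏ps (*-comm p (product ps)))

noPrimeDivisor⇒≡1 : 1 ≤ n → (∀ {p} → Prime p → ¬ p ∣ n) → n ≡ 1
noPrimeDivisor⇒≡1 {suc zero} _ _ = refl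
noPrimeDivisor⇒≡1 {suc (suc _)} _ noDivisor =
  let _ , pr , p∣n = primeDivisor (s≤s (s≤s z≤n)) in contradiction p∣n (noDivisor pr)

ValuationsAgree : ℕ → ℕ → Set
ValuationsAgree a b = ∀ {p e} → Prime p → Valuation p a e → Valuation p b e

valuationsAgree-nonZero : 1 ≤ a → ValuationsAgree a b → 1 ≤ b
valuationsAgree-nonZero a≥1 agree = valuation-nonZero prime[2] (agree prime[2] (proj₂ (valuation-exists prime[2] a≥1)))

∣-byValuations : Prime p → 1 ≤ a → ValuationsAgree a b → p ∣ a → p ∣ b
∣-byValuations pr a≥1 agree p∣a with valuation-exists pr a≥1
... | zero  , va = contradiction (∣⇒valuation>0 va p∣a) λ ()
... | suc _ , va = valuation>0⇒∣ (agree pr va)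

valuationsAgree-cancelˡ : 1 ≤ n → 1 ≤ b → ValuationsAgree (n * a) (n * b) → ValuationsAgree a b
valuationsAgree-cancelˡ n≥1 b≥1 agree pr va =
  let _ , vn = valuation-exists pr n≥1
  in valuation-cancelˡ pr b≥1 vn (agree pr (valuation-* pr vn va))

quotient≥1 : 1 ≤ n → (m∣n : m ∣ n) → 1 ≤ quotient m∣n
quotient≥1 n≥1 m∣n = >-nonZero⁻¹ _ {{quotient≢0 m∣n {{>-nonZero n≥1}}}}

≡-byValuations : 1 ≤ a → ValuationsAgree a b → a ≡ b
≡-byValuations = go (<-wellFounded _)
  where
  go : Acc _<_ a → 1 ≤ a → ValuationsAgree a b → a ≡ b
  go {suc zero} _ a≥1 agree = sym (noPrimeDivisor⇒≡1 (valuationsAgree-nonZero a≥1 agree) λ pr p∣b →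
    contradiction (∣⇒valuation>0 (agree pr (valuation-1 pr)) p∣b) λ ())
  go {a@(suc (suc _))} {b} (acc rec) a≥1 agree with primeDivisor (s≤s (s≤s z≤n))
  ... | p , pr , p∣a = begin
    a                 ≡⟨ m∣n⇒n≡m*quotient p∣a ⟩
    p * quotient p∣a  ≡⟨ cong (p *_) (go (rec (quotient-< p∣a)) (quotient≥1 a≥1 p∣a) agree′) ⟩
    p * quotient p∣b  ≡⟨ m∣n⇒n≡m*quotient p∣b ⟨
    b                 ∎
    where
    open ≡-Reasoning
    instance _ = prime⇒nonTrivial pr
    p∣b : p ∣ b
    p∣b = ∣-byValuations pr a≥1 agree p∣a
    agree′ : ValuationsAgree (quotient p∣a) (quotient p∣b)
    agree′ = valuationsAgree-cancelˡ (>-nonZero⁻¹ p {{prime⇒nonZero pr}})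
      (quotient≥1 (valuationsAgree-nonZero a≥1 agree) p∣b)
      (subst₂ ValuationsAgree (m∣n⇒n≡m*quotient p∣a) (m∣n⇒n≡m*quotient p∣b) agree)

valuation-product : ∀ {A : Set} {f h : A → ℕ} → Prime p → (∀ x → Valuation p (f x) (h x)) →
                    ∀ xs → Valuation p (product (map f xs)) (sum (map h xs))
valuation-product pr v []       = valuation-1 pr
valuation-product pr v (x ∷ xs) = valuation-* pr (v x) (valuation-product pr v xs)

squareFree⇒valuation≤1 : Prime p → SquareFree n → Valuation p n e → e ≤ 1
squareFree⇒valuation≤1 {e = zero}        _  _  _ = z≤n
squareFree⇒valuation≤1 {e = suc zero}    _  _  _ = s≤s z≤n
squareFree⇒valuation≤1 {p} {e = suc (suc e)} pr sqf (valuation m refl _) =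
  contradiction (divides (p ^ e * m) (solve 3 (λ p x m → p :* (p :* x) :* m := x :* m :* (p :* p)) refl p (p ^ e) m))
                (sqf p (nonTrivial⇒n>1 p {{prime⇒nonTrivial pr}}))

-- Finite sums and increments

≤⇒≤ᵇ≡true : m ≤ n → (m ≤ᵇ n) ≡ true
≤⇒≤ᵇ≡true = Equivalence.to T-≡ ∘ ≤⇒≤ᵇ

>⇒≤ᵇ≡false : n < m → (m ≤ᵇ n) ≡ false
>⇒≤ᵇ≡false {n} {m} n<m with m ≤ᵇ n in m≤ᵇn
... | false = refl
... | true  = contradiction (≤ᵇ⇒≤ m n (Equivalence.from T-≡ m≤ᵇn)) (<⇒≱ n<m)

sumBelow : ℕ → (ℕ → ℕ) → ℕ
sumBelow zero    f = 0
sumBelow (suc n) f = sumBelow n f + f n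

sumBelow-cong : (∀ m → m < n → f m ≡ h m) → sumBelow n f ≡ sumBelow n h
sumBelow-cong {zero}  _    = refl
sumBelow-cong {suc n} f≡h = cong₂ _+_ (sumBelow-cong λ m m<n → f≡h m (m<n⇒m<1+n m<n)) (f≡h n ≤-refl)

sumBelow-zero : (∀ m → m < n → f m ≡ 0) → sumBelow n f ≡ 0
sumBelow-zero {zero}  _  = refl
sumBelow-zero {suc n} f≡0 = cong₂ _+_ (sumBelow-zero λ m m<n → f≡0 m (m<n⇒m<1+n m<n)) (f≡0 n ≤-refl)

sumBelow-single : m < n → (∀ m′ → m′ < n → m′ ≢ m → f m′ ≡ 0) → sumBelow n f ≡ f m
sumBelow-single {m} {suc n} {f} m<1+n f≡0 with m ≟ n
... | yes refl = cong (_+ f m) (sumBelow-zero λ m′ m′<m → f≡0 m′ (m<n⇒m<1+n m′<m) (<⇒≢ m′<m))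
... | no  m≢n  = trans (cong₂ _+_ (sumBelow-single m<n λ m′ m′<n → f≡0 m′ (m<n⇒m<1+n m′<n))
                                  (f≡0 n ≤-refl (≢-sym m≢n)))
                       (+-identityʳ (f m))
  where
  m<n : m < n
  m<n = ≤∧≢⇒< (≤-pred m<1+n) m≢n

sumBelow>0 : 1 ≤ sumBelow n f → ∃ λ m → m < n × 1 ≤ f m
sumBelow>0 {suc n} {f} s>0 with f n in fn≡
... | suc _ = n , ≤-refl , subst (1 ≤_) (sym fn≡) (s≤s z≤n)
... | zero  with sumBelow>0 {n} (subst (1 ≤_) (+-identityʳ _) s>0)
...   | m , m<n , fm>0 = m , m<n⇒m<1+n m<n , fm>0

sumBelow-+ : sumBelow n (λ m → f m + h m) ≡ sumBelow n f + sumBelow n h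
sumBelow-+ {zero}          = refl
sumBelow-+ {suc n} {f} {h} =
  trans (cong (_+ (f n + h n)) (sumBelow-+ {n})) (interchange (sumBelow n f) (sumBelow n h) (f n) (h n))

sum-sumBelow-swap : ∀ {A : Set} (F : A → ℕ → ℕ) xs →
  sum (map (λ x → sumBelow n (F x)) xs) ≡ sumBelow n (λ m → sum (map (λ x → F x m) xs))
sum-sumBelow-swap {n} F []       = sym (sumBelow-zero {n} λ _ _ → refl)
sum-sumBelow-swap {n} F (x ∷ xs) = trans (cong (sumBelow n (F x) +_) (sum-sumBelow-swap {n} F xs)) (sym (sumBelow-+ {n}))

sumBelow-≤ᵇ : m < n → sumBelow n (λ m′ → if m′ ≤ᵇ m then f m′ else 0) ≡ sumBelow (suc m) f
sumBelow-≤ᵇ {m} {suc n} {f} m<1+n with m ≟ n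
... | yes refl = cong₂ _+_ (sumBelow-cong {m} λ m′ m′<m →
                                cong (if_then f m′ else 0) (≤⇒≤ᵇ≡true (<⇒≤ m′<m)))
                           (cong (if_then f m else 0) (≤⇒≤ᵇ≡true (≤-refl {m})))
... | no  m≢n  = trans (cong₂ _+_ (sumBelow-≤ᵇ {f = f} m<n) (cong (if_then f n else 0) (>⇒≤ᵇ≡false m<n)))
                       (+-identityʳ _)
  where
  m<n : m < n
  m<n = ≤∧≢⇒< (≤-pred m<1+n) m≢n

Δ : (ℕ → ℕ) → ℕ → ℕ
Δ w zero    = w zero
Δ w (suc m) = w (suc m) ∸ w m

Δ≤ : ∀ w m → Δ w m ≤ w m
Δ≤ w zero    = ≤-refl
Δ≤ w (suc m) = m∸n≤m (w (suc m)) (w m)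

sumBelow-Δ : ∀ w → (∀ m → m < n → w m ≤ w (suc m)) → sumBelow (suc n) (Δ w) ≡ w n
sumBelow-Δ {zero}  w _    = refl
sumBelow-Δ {suc n} w step = trans (cong (_+ Δ w (suc n)) (sumBelow-Δ w λ m m<n → step m (m<n⇒m<1+n m<n)))
                                  (m+[n∸m]≡n (step n ≤-refl))

Δ>0⇒¬later-Δ>0 : ∀ w → (∀ {a b} → a ≤ b → b < n → w a ≤ w b) → (∀ m → m < n → w m ≤ 1) →
                   ∀ {m m′} → m < m′ → m′ < n → 1 ≤ Δ w m → ¬ 1 ≤ Δ w m′
Δ>0⇒¬later-Δ>0 w mono ≤1 {m} {suc m″} (s≤s m≤m″) 1+m″<n Δm>0 Δ1+m″>0 = <-irrefl refl (begin-strict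
  1          ≤⟨ Δm>0 ⟩
  Δ w m      ≤⟨ Δ≤ w m ⟩
  w m        ≤⟨ mono m≤m″ (<-trans (n<1+n m″) 1+m″<n) ⟩
  w m″       <⟨ m∸n≢0⇒n<m (n>0⇒n≢0 Δ1+m″>0) ⟩
  w (suc m″) ≤⟨ ≤1 (suc m″) 1+m″<n ⟩
  1          ∎)
  where open ≤-Reasoning

Δ>0-unique : ∀ w → (∀ {a b} → a ≤ b → b < n → w a ≤ w b) → (∀ m → m < n → w m ≤ 1) →
             ∀ {m m′} → m < n → m′ < n → 1 ≤ Δ w m → 1 ≤ Δ w m′ → m ≡ m′
Δ>0-unique w mono ≤1 {m} {m′} m<n m′<n Δm>0 Δm′>0 with <-cmp m m′
... | tri< m<m′ _ _ = contradiction Δm′>0 (Δ>0⇒¬later-Δ>0 w mono ≤1 m<m′ m′<n Δm>0)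
... | tri≈ _ m≡m′ _ = m≡m′
... | tri> _ _ m′<m = contradiction Δm>0 (Δ>0⇒¬later-Δ>0 w mono ≤1 m′<m m<n Δm′>0)

[_]·_ : ∀ {P : Set} → Dec P → ℕ → ℕ
[ d ]· x = if does d then x else 0

module _ {P : Set} where

  iverson-yes : ∀ (d : Dec P) {x} → P → [ d ]· x ≡ x
  iverson-yes (yes _) _ = refl
  iverson-yes (no ¬p) p = contradiction p ¬p

  iverson-zero : ∀ (d : Dec P) {x} → (P → x ≡ 0) → [ d ]· x ≡ 0
  iverson-zero (yes p) x≡0 = x≡0 p
  iverson-zero (no _)  _   = refl

  iverson-cong : ∀ (d : Dec P) {x y} → (P → x ≡ y) → [ d ]· x ≡ [ d ]· y
  iverson-cong (yes p) x≡y = x≡y p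
  iverson-cong (no _)  _   = refl

  iverson>0 : ∀ (d : Dec P) {x} → 1 ≤ [ d ]· x → P × 1 ≤ x
  iverson>0 (yes p) x>0 = p , x>0

-- Subsets, sorting and tail sets

_≟ˢ_ : ∀ {k} → DecidableEquality (Subset k)
_≟ˢ_ = ≡-dec Bool._≟_

sum-map-const-0 : ∀ {A : Set} (xs : List A) → sum (map (λ _ → 0) xs) ≡ 0
sum-map-const-0 []       = refl
sum-map-const-0 (_ ∷ xs) = sum-map-const-0 xs

sum-allSubsets-indicator : ∀ {k} (X : Subset k) a →
  sum (map (λ I → [ I ≟ˢ X ]· a) (allSubsets k)) ≡ a
sum-allSubsets-indicator []      a = +-identityʳ a
sum-allSubsets-indicator {suc k} (b ∷ X) a = begin
  sum (map F (map (false ∷_) A ++ map (true ∷_) A))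
    ≡⟨ cong sum (map-++ F (map (false ∷_) A) _) ⟩
  sum (map F (map (false ∷_) A) ++ map F (map (true ∷_) A))
    ≡⟨ sum-++ (map F (map (false ∷_) A)) _ ⟩
  sum (map F (map (false ∷_) A)) + sum (map F (map (true ∷_) A))
    ≡⟨ cong₂ _+_ (cong sum (map-∘ A)) (cong sum (map-∘ A)) ⟨
  sum (map (F ∘ (false ∷_)) A) + sum (map (F ∘ (true ∷_)) A)
    ≡⟨ split b ⟩
  a ∎
  where
  open ≡-Reasoning
  A : List (Subset k)
  A = allSubsets k
  F : Subset (suc k) → ℕ
  F I = [ I ≟ˢ (b ∷ X) ]· a
  split : ∀ b → sum (map (λ I → [ (false ∷ I) ≟ˢ (b ∷ X) ]· a) A)
              + sum (map (λ I → [ (true ∷ I) ≟ˢ (b ∷ X) ]· a) A) ≡ a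
  split false = trans (cong₂ _+_ (sum-allSubsets-indicator X a) (sum-map-const-0 A)) (+-identityʳ a)
  split true  = trans (cong (_+ sum (map (λ I → [ I ≟ˢ X ]· a) A)) (sum-map-const-0 A))
                      (sum-allSubsets-indicator X a)

argmin : ∀ {k} (v : Fin (suc k) → ℕ) → Σ (Fin (suc k)) λ j → ∀ x → v j ≤ v x
argmin {zero}  v = zero , λ { zero → ≤-refl }
argmin {suc k} v with argmin (λ x → v (suc x))
... | j , vj≤ with v zero ≤? v (suc j)
...   | yes v0≤vj = zero    , λ { zero → ≤-refl ; (suc x) → ≤-trans v0≤vj (vj≤ x) }
...   | no  v0≰vj = suc j , λ { zero → <⇒≤ (≰⇒> v0≰vj) ; (suc x) → vj≤ x }

sortingPermutation : ∀ {k} (v : Fin k → ℕ) → Σ (Permutation′ k) (Sorted v)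
sortingPermutation {zero}  v = id , λ ()
sortingPermutation {suc k} v with argmin v
... | j , vj≤ with sortingPermutation (λ x → v (PC.transpose zero j (suc x)))
...   | τ , τ-sorted = σ , sorted
  where
  σ : Permutation′ (suc k)
  σ = lift₀ τ ∘ₚ transpose zero j
  sorted : Sorted v σ
  sorted zero    y       _         rewrite dec-true (_≟ᶠ_ {suc k} zero zero) refl = vj≤ (σ ⟨$⟩ʳ y)
  sorted (suc x) (suc y) (s≤s x≤y) = τ-sorted x y x≤y

module _ (σ : Permutation′ k) where

  lookup-tailSet : ∀ m j → lookup (tailSet σ m) j ≡ (m ≤ᵇ toℕ (σ ⟨$⟩ˡ j))
  lookup-tailSet m j = lookup∘tabulate _ j

  lookup-tailSet-σ : (n<k : n < k) → lookup (tailSet σ m) (σ ⟨$⟩ʳ fromℕ< n<k) ≡ (m ≤ᵇ n)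
  lookup-tailSet-σ {m = m} n<k =
    trans (lookup-tailSet m _) (cong (m ≤ᵇ_) (trans (cong toℕ (inverseˡ σ)) (toℕ-fromℕ< n<k)))

  σ∈tailSet : (m<k : m < k) → lookup (tailSet σ m) (σ ⟨$⟩ʳ fromℕ< m<k) ≡ true
  σ∈tailSet {m} m<k = trans (lookup-tailSet-σ {m = m} m<k) (≤⇒≤ᵇ≡true (≤-refl {m}))

  σ∈tailSet⇒≤ : (n<k : n < k) → lookup (tailSet σ m) (σ ⟨$⟩ʳ fromℕ< n<k) ≡ true → m ≤ n
  σ∈tailSet⇒≤ {n} {m} n<k ∈ = ≤ᵇ⇒≤ m n (Equivalence.from T-≡ (trans (sym (lookup-tailSet-σ {m = m} n<k)) ∈))

  tailSet-injective : m < k → n < k → tailSet σ m ≡ tailSet σ n → m ≡ n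
  tailSet-injective m<k n<k Tm≡Tn = ≤-antisym
    (σ∈tailSet⇒≤ n<k (subst (λ S → lookup S _ ≡ true) (sym Tm≡Tn) (σ∈tailSet n<k)))
    (σ∈tailSet⇒≤ m<k (subst (λ S → lookup S _ ≡ true) Tm≡Tn (σ∈tailSet m<k)))

  tailSet≢∅ : m < k → tailSet σ m ≢ ∅
  tailSet≢∅ {m} m<k Tm≡∅ = contradiction (begin
      true                   ≡⟨ σ∈tailSet m<k ⟨
      lookup (tailSet σ m) j ≡⟨ cong (λ S → lookup S j) Tm≡∅ ⟩
      lookup ∅ j             ≡⟨ lookup-replicate j false ⟩
      false                  ∎) λ ()
    where
    open ≡-Reasoning
    j : Fin k
    j = σ ⟨$⟩ʳ fromℕ< m<k

  tailSet-antitone : m ≤ n → tailSet σ n ⊆ tailSet σ m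
  tailSet-antitone {m} {n} m≤n {j} j∈Tn = lookup⇒[]= j _ (trans (lookup-tailSet m j) (≤⇒≤ᵇ≡true
    (≤-trans m≤n (≤ᵇ⇒≤ n _ (Equivalence.from T-≡ (trans (sym (lookup-tailSet n j)) ([]=⇒lookup j∈Tn)))))))

  tailSet-total : ∀ m n → tailSet σ m ⊆ tailSet σ n ⊎ tailSet σ n ⊆ tailSet σ m
  tailSet-total m n with ≤-total m n
  ... | inj₁ m≤n = inj₂ (tailSet-antitone m≤n)
  ... | inj₂ n≤m = inj₁ (tailSet-antitone n≤m)

module Exponents {k} (v : Fin k → ℕ) (σ : Permutation′ k) (sorted : Sorted v σ) where

  -- w m = v (σ m) is the m-th smallest valuation; the junk value 0 past the end is never used.
  w : ℕ → ℕ
  w m with m <? k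
  ... | yes m<k = v (σ ⟨$⟩ʳ fromℕ< m<k)
  ... | no  _   = 0

  w-fromℕ< : (m<k : m < k) → w m ≡ v (σ ⟨$⟩ʳ fromℕ< m<k)
  w-fromℕ< {m} m<k with m <? k
  ... | yes _  = refl
  ... | no m≮k = contradiction m<k m≮k

  w-toℕ : ∀ i → w (toℕ i) ≡ v (σ ⟨$⟩ʳ i)
  w-toℕ i = trans (w-fromℕ< (toℕ<n i)) (cong (λ j → v (σ ⟨$⟩ʳ j)) (fromℕ<-toℕ i (toℕ<n i)))

  w-mono : ∀ {a b} → a ≤ b → b < k → w a ≤ w b
  w-mono {a} {b} a≤b b<k = subst₂ _≤_ (sym (w-fromℕ< a<k)) (sym (w-fromℕ< b<k))
    (sorted (fromℕ< a<k) (fromℕ< b<k) (subst₂ _≤_ (sym (toℕ-fromℕ< a<k)) (sym (toℕ-fromℕ< b<k)) a≤b))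
    where
    a<k : a < k
    a<k = ≤-<-trans a≤b b<k

  exponent : Subset k → ℕ
  exponent I = sumBelow k (λ m → [ I ≟ˢ tailSet σ m ]· Δ w m)

  exponent-tailSet : m < k → exponent (tailSet σ m) ≡ Δ w m
  exponent-tailSet {m} m<k = trans
    (sumBelow-single m<k λ m′ m′<k m′≢m →
      iverson-zero (tailSet σ m ≟ˢ tailSet σ m′) λ Tm≡Tm′ →
        contradiction (tailSet-injective σ m′<k m<k (sym Tm≡Tm′)) m′≢m)
    (iverson-yes (tailSet σ m ≟ˢ tailSet σ m) refl)

  exponent-nonTail : ∀ I → (∀ m → m < k → I ≢ tailSet σ m) → exponent I ≡ 0
  exponent-nonTail I I≢T = sumBelow-zero λ m m<k →
    iverson-zero (I ≟ˢ tailSet σ m) λ I≡Tm → contradiction I≡Tm (I≢T m m<k)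

  exponent-∅ : exponent ∅ ≡ 0
  exponent-∅ = exponent-nonTail ∅ λ m m<k ∅≡Tm → tailSet≢∅ σ m<k (sym ∅≡Tm)

  exponent-expoSpec : ∀ I → ExpoSpec v σ I (exponent I)
  exponent-expoSpec I = first , successor , otherwise
    where
    first : ∀ i → toℕ i ≡ 0 → I ≡ tailSet σ 0 → exponent I ≡ v (σ ⟨$⟩ʳ i)
    first i i≡0 refl = trans (exponent-tailSet (subst (_< k) i≡0 (toℕ<n i))) (trans (cong w (sym i≡0)) (w-toℕ i))
    successor : ∀ i j → toℕ j ≡ suc (toℕ i) → I ≡ tailSet σ (toℕ j) →
                exponent I ≡ v (σ ⟨$⟩ʳ j) ∸ v (σ ⟨$⟩ʳ i)
    successor i j j≡1+i refl = trans (exponent-tailSet (toℕ<n j))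
      (trans (cong (Δ w) j≡1+i) (cong₂ _∸_ (trans (cong w (sym j≡1+i)) (w-toℕ j)) (w-toℕ i)))
    otherwise : (∀ i → I ≢ tailSet σ (toℕ i)) → exponent I ≡ 0
    otherwise I≢T = exponent-nonTail I λ m m<k I≡Tm →
      I≢T (fromℕ< m<k) (trans I≡Tm (cong (tailSet σ) (sym (toℕ-fromℕ< m<k))))

  exponent>0⇒tailSet : ∀ I → 1 ≤ exponent I → ∃ λ m → m < k × I ≡ tailSet σ m × 1 ≤ Δ w m
  exponent>0⇒tailSet I exponent>0 =
    let m , m<k , term>0 = sumBelow>0 exponent>0
        I≡Tm , Δ>0 = iverson>0 (I ≟ˢ tailSet σ m) term>0
    in m , m<k , I≡Tm , Δ>0

  sum-exponent-containing : ∀ i → sum (map (λ I → if lookup I i then exponent I else 0) (allSubsets k)) ≡ v i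
  sum-exponent-containing i = begin
    sum (map (λ I → if lookup I i then exponent I else 0) L)
      ≡⟨ cong sum (map-cong restrict L) ⟩
    sum (map (λ I → sumBelow k (λ m → [ I ≟ˢ tailSet σ m ]· δ m)) L)
      ≡⟨ sum-sumBelow-swap {k} (λ I m → [ I ≟ˢ tailSet σ m ]· δ m) L ⟩
    sumBelow k (λ m → sum (map (λ I → [ I ≟ˢ tailSet σ m ]· δ m) L))
      ≡⟨ sumBelow-cong {k} (λ m _ → sum-allSubsets-indicator (tailSet σ m) (δ m)) ⟩
    sumBelow k δ
      ≡⟨ sumBelow-cong {k} (λ m _ → cong (if_then Δ w m else 0) (lookup-tailSet σ m i)) ⟩
    sumBelow k (λ m → if m ≤ᵇ π then Δ w m else 0)
      ≡⟨ sumBelow-≤ᵇ π<k ⟩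
    sumBelow (suc π) (Δ w)
      ≡⟨ sumBelow-Δ w (λ m m<π → w-mono (n≤1+n m) (≤-<-trans m<π π<k)) ⟩
    w π
      ≡⟨ w-toℕ (σ ⟨$⟩ˡ i) ⟩
    v (σ ⟨$⟩ʳ (σ ⟨$⟩ˡ i))
      ≡⟨ cong v (inverseʳ σ) ⟩
    v i ∎
    where
    open ≡-Reasoning
    L : List (Subset k)
    L = allSubsets k
    π : ℕ
    π = toℕ (σ ⟨$⟩ˡ i)
    π<k : π < k
    π<k = toℕ<n (σ ⟨$⟩ˡ i)
    δ : ℕ → ℕ
    δ m = if lookup (tailSet σ m) i then Δ w m else 0
    restrict : ∀ I → (if lookup I i then exponent I else 0) ≡ sumBelow k (λ m → [ I ≟ˢ tailSet σ m ]· δ m)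
    restrict I with lookup I i in I∋i
    ... | true  = sumBelow-cong {k} λ m _ →
                    iverson-cong (I ≟ˢ tailSet σ m) λ { refl → cong (if_then Δ w m else 0) (sym I∋i) }
    ... | false = sym (sumBelow-zero {k} λ m _ →
                    iverson-zero (I ≟ˢ tailSet σ m) λ { refl → cong (if_then Δ w m else 0) I∋i })

-- Relative gcds

module RelativeGCDs {k} (q : Fin k → ℕ) (g : Subset k → ℕ) (q≥1 : ∀ i → 1 ≤ q i) (isRelGCD : IsRelGCD q g) where

  g≥1 : ∀ I → 1 ≤ g I
  g≥1 I with I ≟ˢ ∅
  ... | yes refl = ≤-reflexive (sym (proj₁ isRelGCD))
  ... | no  I≢∅  = proj₁ (proj₂ isRelGCD) I I≢∅

  module AtPrime {p} (pr : Prime p) where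

    v : Fin k → ℕ
    v i = proj₁ (valuation-exists pr (q≥1 i))

    v-valuation : ∀ i → Valuation p (q i) (v i)
    v-valuation i = proj₂ (valuation-exists pr (q≥1 i))

    σ : Permutation′ k
    σ = proj₁ (sortingPermutation v)

    sorted : Sorted v σ
    sorted = proj₂ (sortingPermutation v)

    open Exponents v σ sorted public

    g-valuation : ∀ I → Valuation p (g I) (exponent I)
    g-valuation I with I ≟ˢ ∅
    ... | yes refl = subst₂ (Valuation p) (sym (proj₁ isRelGCD)) (sym exponent-∅) (valuation-1 pr)
    ... | no  I≢∅  = isVal⇒valuation (proj₂ (proj₂ isRelGCD) p pr v (valuation⇒isVal pr ∘ v-valuation)
                       σ sorted I I≢∅ (exponent I) (exponent-expoSpec I))

    squareFree⇒w≤1 : (∀ i → SquareFree (q i)) → ∀ m → m < k → w m ≤ 1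
    squareFree⇒w≤1 sqf m m<k = subst (_≤ 1) (sym (w-fromℕ< m<k)) (squareFree⇒valuation≤1 pr (sqf _) (v-valuation _))

    p∣g⇒tailSet : ∀ I → p ∣ g I → ∃ λ m → m < k × I ≡ tailSet σ m × 1 ≤ Δ w m
    p∣g⇒tailSet I p∣gI = exponent>0⇒tailSet I (∣⇒valuation>0 (g-valuation I) p∣gI)

    prodContaining-valuation : ∀ i → Valuation p (prodContaining g i) (v i)
    prodContaining-valuation i =
      subst (Valuation p (prodContaining g i)) (sum-exponent-containing i) (valuation-product pr factor (allSubsets k))
      where
      factor : ∀ I → Valuation p (if lookup I i then g I else 1) (if lookup I i then exponent I else 0)
      factor I with lookup I i
      ... | true  = g-valuation I
      ... | false = valuation-1 pr

  q≡prodContaining : ∀ i → q i ≡ prodContaining g i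
  q≡prodContaining i = ≡-byValuations (q≥1 i) λ pr vq →
    let open AtPrime pr
    in subst (Valuation _ (prodContaining g i)) (valuation-unique pr (v-valuation i) vq) (prodContaining-valuation i)

  gcd>1⇒nested : ∀ I J → 1 < gcd (g I) (g J) → I ⊆ J ⊎ J ⊆ I
  gcd>1⇒nested I J gcd>1 =
    let p , pr , p∣gcd = primeDivisor gcd>1
        open AtPrime pr
        m , _ , I≡Tm , _ = p∣g⇒tailSet I (∣-trans p∣gcd (gcd[m,n]∣m (g I) (g J)))
        n , _ , J≡Tn , _ = p∣g⇒tailSet J (∣-trans p∣gcd (gcd[m,n]∣n (g I) (g J)))
    in subst₂ (λ I J → I ⊆ J ⊎ J ⊆ I) (sym I≡Tm) (sym J≡Tn) (tailSet-total σ m n)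

  squareFree⇒coprime : (∀ i → SquareFree (q i)) → ∀ I J → I ≢ J → gcd (g I) (g J) ≡ 1
  squareFree⇒coprime sqf I J I≢J = noPrimeDivisor⇒≡1 gcd≥1 λ pr p∣gcd →
    let open AtPrime pr
        m , m<k , I≡Tm , Δm>0 = p∣g⇒tailSet I (∣-trans p∣gcd (gcd[m,n]∣m (g I) (g J)))
        n , n<k , J≡Tn , Δn>0 = p∣g⇒tailSet J (∣-trans p∣gcd (gcd[m,n]∣n (g I) (g J)))
        m≡n = Δ>0-unique w w-mono (squareFree⇒w≤1 sqf) m<k n<k Δm>0 Δn>0
    in I≢J (trans I≡Tm (trans (cong (tailSet σ) m≡n) (sym J≡Tn)))
    where
    gcd≥1 : 1 ≤ gcd (g I) (g J)
    gcd≥1 = n≢0⇒n>0 (gcd[m,n]≢0 (g I) (g J) (inj₁ (n>0⇒n≢0 (g≥1 I))))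

lemmaA1 : ∀ (k : ℕ) (q : Fin k → ℕ) (g : Subset k → ℕ)
    → (∀ i → 1 ≤ q i)
    → IsRelGCD q g
    → (∀ i → q i ≡ prodContaining g i)
      × (∀ I J → 1 < gcd (g I) (g J) → I ⊆ J ⊎ J ⊆ I)
      × ((∀ i → SquareFree (q i)) → ∀ I J → I ≢ J → gcd (g I) (g J) ≡ 1)
lemmaA1 k q g q≥1 isRelGCD = q≡prodContaining , gcd>1⇒nested , squareFree⇒coprime
  where open RelativeGCDs q g q≥1 isRelGCD
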